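{- In the setting described in the context, if there is a feasible solution of problem BPUP' for the instance $I'$ that uses $B$ bins, then the configuration linear program described in the context has a feasible solution of cost at most $B$.
   Context: BPUP: items with sizes $s_i\in[0,1]$, a rational $U\in(0,1]$, a positive integer $k$, bins of capacity 1; the load of a nonempty set $p$ in a bin is $\sum_{i\in p}s_i+\lfloor(|p|-1)/k\rfloor U$. Let $\varepsilon>0$ with $1/\varepsilon\in\mathbb{Z}$ and assume $\lfloor k/U\rfloor+k>1/\varepsilon^2$. An item is small if its size is $<\varepsilon$ and large otherwise. $I'$ is an instance consisting of a set $\mathcal{S}$ of small items and a set of large items (sizes $\ge\varepsilon$); $Z$ is the set of distinct large item sizes in $I'$ and $n(z)$ the number of large items of size $z$. Problem BPUP': for a bin $p$, sort its items in non-increasing size, ties broken by increasing index; the early items $E_p$ are the first $k/\varepsilon$ items, the late items $\Lambda_p$ are the rest. Late items have modified size $\tilde s_i=s_i+U/k$. The load of $p$ is $\sum_{i\in E_p}s_i+\sum_{i\in\Lambda_p}\tilde s_i+\frac{|E_p|}{k}U$ if $\Lambda_p\neq\emptyset$, and $\sum_{i\in E_p}s_i+\lfloor(|E_p|-1)/k\rfloor U$ otherwise. A feasible solution partitions the items of $I'$ into bins of load at most $1$. Configurations: $c$ consists of nonnegative integers $\alpha_{cz}$ ($z\in Z$), a nonnegative integer $\delta_c$, an integer $\gamma_c\in\{0,1,\dots,1/\varepsilon\}$ and a bit $\gamma'_c\in\{0,1\}$ (with $\gamma_c=0$ if $\gamma'_c=0$). Its load is $L_c=\sum_z\alpha_{cz}z+\gamma'_c\gamma_c\varepsilon+(\delta_c-1+\gamma'_c)U$,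 and $c$ is feasible if $L_c\le1$; $\mathcal{C}$ is the set of feasible configurations; put $\beta_c=1-L_c$. Let $H=\{0,1,\dots,1/\varepsilon\}$. The configuration LP has variables $u_c\ge0$ ($c\in\mathcal{C}$), $v_{i\eta},w_{i\eta}\ge0$ ($i\in\mathcal{S},\eta\in H$); it minimizes $\sum_c u_c$ subject to: $\sum_c u_c\alpha_{cz}\ge n(z)$ for all $z\in Z$; $\sum_{\eta\in H}(v_{i\eta}+w_{i\eta})\ge1$ for all $i\in\mathcal{S}$; for every $\eta\in H$: $\sum_{i\in\mathcal{S}}v_{i\eta}s_i\le\sum_{c:\gamma_c=\eta}u_c\beta_c$, $\ \sum_{i\in\mathcal{S}}w_{i\eta}\tilde s_i\le\sum_{c:\gamma_c=\eta}u_c\gamma'_c(\gamma_c+1)\varepsilon$, and $\sum_{c:\gamma_c=\eta}u_c\sum_z\alpha_{cz}+\sum_{i\in\mathcal{S}}v_{i\eta}\le\sum_{c:\gamma_c=\eta}u_c\delta_ck$. -}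

module Defs where

open import Data.Nat as ℕ using (ℕ; zero; suc; _∸_)
open import Data.Integer as ℤ using (ℤ; +_)
open import Data.Rational as ℚ
  using (ℚ; 0ℚ; 1ℚ; _+_; _*_; _-_; _≤_; _<_; _÷_; floor; >-nonZero)
open import Data.Rational.Properties as ℚP using ()
open import Data.Fin as Fin using (Fin; toℕ)
import Data.Fin.Properties as FinP
open import Data.List using (List; []; _∷_; map; filter; foldr; length; allFin; deduplicate; lookup)
open import Data.List.Relation.Unary.All using (All)
open import Data.Bool using (Bool; true; false)
import Data.Sum
import Relation.Nullary
import Data.List
import Data.Nat.ListAction as ListAction
open import Data.Product using (_×_; _,_; proj₁; proj₂; Σ-syntax)
open import Relation.Binary.PropositionalEquality using (_≡_)
open import Relation.Nullary.Decidable using (_×-dec_; _⊎-dec_; ¬?)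

ℚ-of : ℕ → ℚ
ℚ-of n = + n ℚ./ 1

Σℚ : List ℚ → ℚ
Σℚ = foldr _+_ 0ℚ

kOverU : ℕ → (U : ℚ) → 0ℚ < U → ℚ
kOverU k U U>0 = _÷_ (ℚ-of k) U {{>-nonZero U>0}}

bit : Bool → ℕ
bit false = 0
bit true  = 1

module Setting (m k : ℕ) (m≢0 : ℕ.NonZero m) (k≢0 : ℕ.NonZero k)
               (U : ℚ) {n : ℕ} (s : Fin n → ℚ) where

  private instance
    m≢0-inst : ℕ.NonZero m
    m≢0-inst = m≢0
    k≢0-inst : ℕ.NonZero k
    k≢0-inst = k≢0

  ε : ℚ
  ε = + 1 ℚ./ m

  Small : Fin n → Set
  Small i = s i < ε

  small? : (i : Fin n) → Relation.Nullary.Dec (Small i)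
  small? i = s i ℚP.<? ε

  large? : (i : Fin n) → Relation.Nullary.Dec (ε ≤ s i)
  large? i = ε ℚP.≤? s i

  smallItems : List (Fin n)
  smallItems = filter small? (allFin n)

  ΣS : (Fin n → ℚ) → ℚ
  ΣS g = Σℚ (map g smallItems)

  s̃ : Fin n → ℚ
  s̃ i = s i + U * (+ 1 ℚ./ k)

  precedes? : (j i : Fin n) → Relation.Nullary.Dec ((s i < s j) Data.Sum.⊎ ((s j ≡ s i) × (j Fin.< i)))
  precedes? j i = (s i ℚP.<? s j) ⊎-dec ((s j ℚP.≟ s i) ×-dec (j FinP.<? i))

  module _ {B : ℕ} (f : Fin n → Fin B) where
    binItems : Fin B → List (Fin n)
    binItems b = filter (λ i → f i FinP.≟ b) (allFin n)

    -- position (0-based) of item i in the sorted order of its own bin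
    rank : Fin n → ℕ
    rank i = length (filter (λ j → (f j FinP.≟ f i) ×-dec precedes? j i) (allFin n))

    -- early items: the first k/ε = k·m items of the bin
    early? : (i : Fin n) → Relation.Nullary.Dec (rank i ℕ.< k ℕ.* m)
    early? i = rank i ℕ.<? k ℕ.* m

    Early : Fin B → List (Fin n)
    Early b = filter early? (binItems b)

    Late : Fin B → List (Fin n)
    Late b = filter (λ i → ¬? (early? i)) (binItems b)

    loadWith : List (Fin n) → List (Fin n) → ℚ
    loadWith E [] =
      Σℚ (map s E) + ℚ-of ((length E ∸ 1) ℕ./ k) * U
    loadWith E Λ@(_ ∷ _) =
      Σℚ (map s E) + Σℚ (map s̃ Λ) + (ℚ-of (length E) * (+ 1 ℚ./ k)) * U

    load : Fin B → ℚ
    load b = loadWith (Early b) (Late b)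

    FeasibleBPUP' : Set
    FeasibleBPUP' = (b : Fin B) → load b ≤ 1ℚ

  Z : List ℚ
  Z = deduplicate ℚP._≟_ (map s (filter large? (allFin n)))

  nZ : ℕ
  nZ = length Z

  zAt : Fin nZ → ℚ
  zAt = lookup Z

  count : ℚ → ℕ
  count z = length (filter (λ i → large? i ×-dec (s i ℚP.≟ z)) (allFin n))

  -- H = {0,1,...,1/ε} = Fin (suc m)
  record Config : Set where
    field
      α   : Fin nZ → ℕ
      δ   : ℕ
      γ   : Fin (suc m)
      γ'  : Bool
      γ'0 : γ' ≡ false → γ ≡ Fin.zero

  open Config public

  L : Config → ℚ
  L c = Σℚ (map (λ j → ℚ-of (α c j) * zAt j) (allFin nZ))
        + ℚ-of (bit (γ' c) ℕ.* toℕ (γ c)) * ε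
        + (ℚ-of (δ c ℕ.+ bit (γ' c)) - 1ℚ) * U

  FeasibleConfig : Config → Set
  FeasibleConfig c = L c ≤ 1ℚ

  β : Config → ℚ
  β c = 1ℚ - L c

  -- a nonnegative vector u indexed by feasible configurations with finite
  -- support, represented as a list of (configuration, value) pairs; the
  -- value u_c is the sum of the entries for c.
  Σc : List (Config × ℚ) → (Config → ℚ) → ℚ
  Σc u g = Σℚ (map (λ p → proj₂ p * g (proj₁ p)) u)

  Σcη : List (Config × ℚ) → Fin (suc m) → (Config → ℚ) → ℚ
  Σcη u η g = Σc (filter (λ p → γ (proj₁ p) FinP.≟ η) u) g

  Σα : Config → ℕ
  Σα c = ListAction.sum (map (α c) (allFin nZ))

  LPFeasible : List (Config × ℚ) → (Fin n → Fin (suc m) → ℚ) →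
               (Fin n → Fin (suc m) → ℚ) → Set
  LPFeasible u v w =
      All (λ p → FeasibleConfig (proj₁ p) × (0ℚ ≤ proj₂ p)) u
    × (∀ i η → 0ℚ ≤ v i η)
    × (∀ i η → 0ℚ ≤ w i η)
    × ((j : Fin nZ) → ℚ-of (count (zAt j)) ≤ Σc u (λ c → ℚ-of (α c j)))
    × ((i : Fin n) → Small i →
         1ℚ ≤ Σℚ (map (λ η → v i η + w i η) (allFin (suc m))))
    × ((η : Fin (suc m)) → ΣS (λ i → v i η * s i) ≤ Σcη u η β)
    × ((η : Fin (suc m)) →
         ΣS (λ i → w i η * s̃ i)
           ≤ Σcη u η (λ c → ℚ-of (bit (γ' c) ℕ.* (toℕ (γ c) ℕ.+ 1)) * ε))
    × ((η : Fin (suc m)) →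
         Σcη u η (λ c → ℚ-of (Σα c)) + ΣS (λ i → v i η)
           ≤ Σcη u η (λ c → ℚ-of (δ c ℕ.* k)))

  cost : List (Config × ℚ) → ℚ
  cost u = Σℚ (map proj₂ u)

  LPSolvableWithin : ℚ → Set
  LPSolvableWithin x =
    Σ[ u ∈ List (Config × ℚ) ] Σ[ v ∈ (Fin n → Fin (suc m) → ℚ) ]
    Σ[ w ∈ (Fin n → Fin (suc m) → ℚ) ] (LPFeasible u v w × (cost u ≤ x))

SizesIn01 : {n : ℕ} → (Fin n → ℚ) → Set
SizesIn01 s = ∀ i → (0ℚ ≤ s i) × (s i ≤ 1ℚ)

-- Every bin b of the packing becomes one configuration, taken with weight 1:
-- α records the large items of b by size, δ = 1 + ⌊(|b| − 1)/k⌋ and γ = γ' = 0.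
-- All small items are assigned to η = 0 through v, and w = 0.  The BPUP' load of b
-- is at least Σ_{i∈b} s_i + ⌊(|b| − 1)/k⌋ U (with late items it equals
-- Σ_{i∈b} s_i + |b| U/k), so the small items of b fit into the slack β of its
-- configuration, and |b| ≤ δ k bounds the number of items placed on it.
module Submission where

open import Defs
open import Data.Nat as ℕ using (ℕ; NonZero)
open import Data.Integer as ℤ using (+_)
open import Data.Rational using (ℚ; 0ℚ; 1ℚ; _≤_; _<_; floor)
open import Data.Fin using (Fin)

open import Algebra.Bundles using (CommutativeMonoid)
open import Data.Bool using (true; false; if_then_else_)
open import Data.Fin using (toℕ)
import Data.Fin as Fin
import Data.Fin.Properties as FinP
import Data.Integer.Properties as ℤP
open import Data.List using (List; []; _∷_; map; filter; length; allFin; lookup; tabulate)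
import Data.List.Properties as LP
open import Data.List.Relation.Unary.All as All using (All; []; _∷_)
import Data.List.Relation.Unary.All.Properties as AllP
open import Data.List.Relation.Unary.AllPairs using ([]; _∷_)
open import Data.List.Relation.Unary.Unique.Propositional using (Unique)
import Data.List.Relation.Unary.Unique.DecPropositional.Properties as Unique
open import Data.Nat using (zero; suc)
import Data.Nat.Coprimality as Coprimality
import Data.Nat.DivMod as DivMod
import Data.Nat.ListAction as ListAction
import Data.Nat.Properties as ℕP
open import Data.Product using (_×_; _,_; proj₁; proj₂)
open import Data.Rational
  using (_+_; _*_; _-_; _/_; mkℚ; toℚᵘ; NonNegative; nonNegative)
import Data.Rational.Properties as ℚP
open import Data.Rational.Solver using (module +-*-Solver)
import Data.Rational.Unnormalised as ℚᵘ
open ℚᵘ using (*≡*)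
import Data.Rational.Unnormalised.Properties as ℚᵘP
open import Relation.Binary.Definitions using (DecidableEquality)
open import Relation.Binary.PropositionalEquality
open import Relation.Nullary using (Dec; yes; no; does; ¬_; ¬?; contradiction)
open import Relation.Nullary.Decidable using (_×-dec_)
open import Relation.Unary using (Pred; Decidable; _≐_)

open import Algebra.Properties.CommutativeSemigroup
  (CommutativeMonoid.commutativeSemigroup ℚP.+-0-commutativeMonoid)
  using () renaming (interchange to +-interchange; x∙yz≈y∙xz to x+[y+z]≡y+[x+z])

ℚ-of≡mkℚ : ∀ n → ℚ-of n ≡ mkℚ (+ n) 0 (Coprimality.sym (Coprimality.1-coprimeTo n))
ℚ-of≡mkℚ n = ℚP.normalize-coprime _

ℚ-of-suc : ∀ n → ℚ-of (suc n) ≡ 1ℚ + ℚ-of n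
ℚ-of-suc n = ℚP.toℚᵘ-injective (ℚᵘP.≃-trans toℚᵘ-suc (ℚᵘP.≃-sym (ℚP.toℚᵘ-homo-+ 1ℚ (ℚ-of n))))
  where
  toℚᵘ-suc : toℚᵘ (ℚ-of (suc n)) ℚᵘ.≃ (toℚᵘ 1ℚ ℚᵘ.+ toℚᵘ (ℚ-of n))
  toℚᵘ-suc rewrite ℚ-of≡mkℚ (suc n) | ℚ-of≡mkℚ n =
    *≡* (trans (ℤP.*-identityʳ _) (sym (trans (ℤP.*-identityʳ _) (cong (ℤ._+_ (+ 1)) (ℤP.*-identityʳ (+ n))))))

ℚ-of-+ : ∀ a b → ℚ-of (a ℕ.+ b) ≡ ℚ-of a + ℚ-of b
ℚ-of-+ zero    b = sym (ℚP.+-identityˡ (ℚ-of b))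
ℚ-of-+ (suc a) b = begin
  ℚ-of (suc (a ℕ.+ b))        ≡⟨ ℚ-of-suc (a ℕ.+ b) ⟩
  1ℚ + ℚ-of (a ℕ.+ b)         ≡⟨ cong (_+_ 1ℚ) (ℚ-of-+ a b) ⟩
  1ℚ + (ℚ-of a + ℚ-of b)      ≡⟨ ℚP.+-assoc 1ℚ (ℚ-of a) (ℚ-of b) ⟨
  (1ℚ + ℚ-of a) + ℚ-of b      ≡⟨ cong (λ x → x + ℚ-of b) (ℚ-of-suc a) ⟨
  ℚ-of (suc a) + ℚ-of b       ∎
  where open ≡-Reasoning

ℚ-of-* : ∀ a b → ℚ-of (a ℕ.* b) ≡ ℚ-of a * ℚ-of b
ℚ-of-* zero    b = sym (ℚP.*-zeroˡ (ℚ-of b))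
ℚ-of-* (suc a) b = begin
  ℚ-of (b ℕ.+ a ℕ.* b)             ≡⟨ ℚ-of-+ b (a ℕ.* b) ⟩
  ℚ-of b + ℚ-of (a ℕ.* b)          ≡⟨ cong₂ _+_ (sym (ℚP.*-identityˡ (ℚ-of b))) (ℚ-of-* a b) ⟩
  1ℚ * ℚ-of b + ℚ-of a * ℚ-of b    ≡⟨ ℚP.*-distribʳ-+ (ℚ-of b) 1ℚ (ℚ-of a) ⟨
  (1ℚ + ℚ-of a) * ℚ-of b           ≡⟨ cong (_* ℚ-of b) (ℚ-of-suc a) ⟨
  ℚ-of (suc a) * ℚ-of b            ∎
  where open ≡-Reasoning

ℚ-of-nonNeg : ∀ n → 0ℚ ≤ ℚ-of n
ℚ-of-nonNeg n = ℚP.nonNegative⁻¹ _ {{ℚP.normalize-nonNeg n 1}}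

ℚ-of-mono-≤ : ∀ {a b} → a ℕ.≤ b → ℚ-of a ≤ ℚ-of b
ℚ-of-mono-≤ {a} {b} a≤b = begin
  ℚ-of a                      ≡⟨ ℚP.+-identityʳ (ℚ-of a) ⟨
  ℚ-of a + 0ℚ                 ≤⟨ ℚP.+-monoʳ-≤ (ℚ-of a) (ℚ-of-nonNeg (b ℕ.∸ a)) ⟩
  ℚ-of a + ℚ-of (b ℕ.∸ a)     ≡⟨ ℚ-of-+ a (b ℕ.∸ a) ⟨
  ℚ-of (a ℕ.+ (b ℕ.∸ a))      ≡⟨ cong ℚ-of (ℕP.m+[n∸m]≡n a≤b) ⟩
  ℚ-of b                      ∎
  where open ℚP.≤-Reasoning

ℚ-of-*-1/ : ∀ k .{{_ : NonZero k}} → ℚ-of k * (+ 1 / k) ≡ 1ℚ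
ℚ-of-*-1/ (suc k) = ℚP.toℚᵘ-injective (ℚᵘP.≃-trans (ℚP.toℚᵘ-homo-* (ℚ-of (suc k)) (+ 1 / suc k)) toℚᵘ-inverse)
  where
  toℚᵘ-inverse : (toℚᵘ (ℚ-of (suc k)) ℚᵘ.* toℚᵘ (+ 1 / suc k)) ℚᵘ.≃ toℚᵘ 1ℚ
  toℚᵘ-inverse rewrite ℚ-of≡mkℚ (suc k) | ℚP.normalize-coprime {1} {k} (Coprimality.1-coprimeTo (suc k)) =
    *≡* (trans (ℤP.*-identityʳ _) (trans (ℤP.*-identityʳ (+ suc k))
          (trans (cong (λ x → + suc x) (sym (ℕP.+-identityʳ k))) (sym (ℤP.*-identityˡ _)))))

when : ∀ {p} {P : Set p} → Dec P → ℚ → ℚ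
when d q = if does d then q else 0ℚ

module _ {a} {A : Set a} where

  ∑ : List A → (A → ℚ) → ℚ
  ∑ xs g = Σℚ (map g xs)

  ∑-cong : ∀ {g h : A → ℚ} xs → (∀ x → g x ≡ h x) → ∑ xs g ≡ ∑ xs h
  ∑-cong xs g≗h = cong Σℚ (LP.map-cong g≗h xs)

  ∑-cong-All : ∀ {g h : A → ℚ} {xs} → All (λ x → g x ≡ h x) xs → ∑ xs g ≡ ∑ xs h
  ∑-cong-All []            = refl
  ∑-cong-All (gx≡hx ∷ eqs) = cong₂ _+_ gx≡hx (∑-cong-All eqs)

  ∑-mono-≤ : ∀ {g h : A → ℚ} xs → (∀ x → g x ≤ h x) → ∑ xs g ≤ ∑ xs h
  ∑-mono-≤ []       g≤h = ℚP.≤-refl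
  ∑-mono-≤ (x ∷ xs) g≤h = ℚP.+-mono-≤ (g≤h x) (∑-mono-≤ xs g≤h)

  ∑-zero : ∀ xs → ∑ xs (λ _ → 0ℚ) ≡ 0ℚ
  ∑-zero []       = refl
  ∑-zero (x ∷ xs) = trans (ℚP.+-identityˡ _) (∑-zero xs)

  ∑-nonNeg : ∀ {g : A → ℚ} xs → (∀ x → 0ℚ ≤ g x) → 0ℚ ≤ ∑ xs g
  ∑-nonNeg xs g≥0 = ℚP.≤-trans (ℚP.≤-reflexive (sym (∑-zero xs))) (∑-mono-≤ xs g≥0)

  ∑-distrib-+ : ∀ (g h : A → ℚ) xs → ∑ xs (λ x → g x + h x) ≡ ∑ xs g + ∑ xs h
  ∑-distrib-+ g h []       = refl
  ∑-distrib-+ g h (x ∷ xs) =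
    trans (cong (_+_ (g x + h x)) (∑-distrib-+ g h xs)) (+-interchange (g x) (h x) (∑ xs g) (∑ xs h))

  ∑-distribʳ-* : ∀ (g : A → ℚ) c xs → ∑ xs g * c ≡ ∑ xs (λ x → g x * c)
  ∑-distribʳ-* g c []       = ℚP.*-zeroˡ c
  ∑-distribʳ-* g c (x ∷ xs) =
    trans (ℚP.*-distribʳ-+ c (g x) (∑ xs g)) (cong (_+_ (g x * c)) (∑-distribʳ-* g c xs))

  ∑-zero-* : ∀ xs (g : A → ℚ) → ∑ xs (λ x → 0ℚ * g x) ≡ 0ℚ
  ∑-zero-* xs g = trans (∑-cong xs (λ x → ℚP.*-zeroˡ (g x))) (∑-zero xs)

  ℚ-of-length : ∀ (xs : List A) → ℚ-of (length xs) ≡ ∑ xs (λ _ → 1ℚ)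
  ℚ-of-length []       = refl
  ℚ-of-length (x ∷ xs) = trans (ℚ-of-suc (length xs)) (cong (_+_ 1ℚ) (ℚ-of-length xs))

  ∑-const : ∀ (xs : List A) c → ∑ xs (λ _ → c) ≡ ℚ-of (length xs) * c
  ∑-const xs c = begin
    ∑ xs (λ _ → c)              ≡⟨ ∑-cong xs (λ _ → ℚP.*-identityˡ c) ⟨
    ∑ xs (λ _ → 1ℚ * c)         ≡⟨ ∑-distribʳ-* (λ _ → 1ℚ) c xs ⟨
    ∑ xs (λ _ → 1ℚ) * c         ≡⟨ cong (_* c) (ℚ-of-length xs) ⟨
    ℚ-of (length xs) * c        ∎
    where open ≡-Reasoning

  module _ {p} {P : Pred A p} (P? : Decidable P) where

    ∑-filter : ∀ (g : A → ℚ) xs → ∑ (filter P? xs) g ≡ ∑ xs (λ x → when (P? x) (g x))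
    ∑-filter g []       = refl
    ∑-filter g (x ∷ xs) with does (P? x)
    ... | true  = cong (_+_ (g x)) (∑-filter g xs)
    ... | false = trans (∑-filter g xs) (sym (ℚP.+-identityˡ _))

    ∑-partition : ∀ (g : A → ℚ) xs →
                  ∑ (filter P? xs) g + ∑ (filter (λ x → ¬? (P? x)) xs) g ≡ ∑ xs g
    ∑-partition g []       = ℚP.+-identityʳ 0ℚ
    ∑-partition g (x ∷ xs) with does (P? x)
    ... | true  = trans (ℚP.+-assoc (g x) _ _) (cong (_+_ (g x)) (∑-partition g xs))
    ... | false = trans (x+[y+z]≡y+[x+z] (∑ (filter P? xs) g) (g x) (∑ (filter (λ x → ¬? (P? x)) xs) g))
                        (cong (_+_ (g x)) (∑-partition g xs))

    length-partition : ∀ (xs : List A) →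
                       length (filter P? xs) ℕ.+ length (filter (λ x → ¬? (P? x)) xs) ≡ length xs
    length-partition []       = refl
    length-partition (x ∷ xs) with does (P? x)
    ... | true  = cong suc (length-partition xs)
    ... | false = trans (ℕP.+-suc _ _) (cong suc (length-partition xs))

  ∑-filter-cong : ∀ {p} {P : Pred A p} (P? : Decidable P) {g h : A → ℚ} xs →
                  (∀ x → P x → g x ≡ h x) → ∑ (filter P? xs) g ≡ ∑ (filter P? xs) h
  ∑-filter-cong P? xs g≗h = ∑-cong-All (All.map (λ {x} → g≗h x) (AllP.all-filter P? xs))

∑-comm : ∀ {a b} {A : Set a} {B : Set b} (xs : List A) (ys : List B) (f : A → B → ℚ) →
         ∑ xs (λ x → ∑ ys (f x)) ≡ ∑ ys (λ y → ∑ xs (λ x → f x y))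
∑-comm []       ys f = sym (∑-zero ys)
∑-comm (x ∷ xs) ys f = trans (cong (_+_ (∑ ys (f x))) (∑-comm xs ys f))
                             (sym (∑-distrib-+ (f x) (λ y → ∑ xs (λ x → f x y)) ys))

∑-allFin-lookup : ∀ {a} {A : Set a} (zs : List A) (g : A → ℚ) →
                  ∑ (allFin (length zs)) (λ j → g (lookup zs j)) ≡ ∑ zs g
∑-allFin-lookup zs g = cong Σℚ (begin
  map (λ j → g (lookup zs j)) (tabulate (λ j → j)) ≡⟨ LP.map-tabulate (λ j → j) (λ j → g (lookup zs j)) ⟩
  tabulate (λ j → g (lookup zs j))                 ≡⟨ LP.map-tabulate (lookup zs) g ⟨
  map g (tabulate (lookup zs))                     ≡⟨ cong (map g) (LP.tabulate-lookup zs) ⟩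
  map g zs                                         ∎)
  where open ≡-Reasoning

∑-allFin-suc : ∀ {B} (g : Fin (suc B) → ℚ) → ∑ (allFin (suc B)) g ≡ g Fin.zero + ∑ (allFin B) (λ b → g (Fin.suc b))
∑-allFin-suc g = cong (λ t → g Fin.zero + Σℚ t)
  (trans (LP.map-tabulate Fin.suc g) (sym (LP.map-tabulate (λ b → b) (λ b → g (Fin.suc b)))))

∑-allFin-when-≟ : ∀ {B} (a : Fin B) c → ∑ (allFin B) (λ b → when (a FinP.≟ b) c) ≡ c
∑-allFin-when-≟ {suc B} Fin.zero c = begin
  ∑ (allFin (suc B)) (λ b → when (Fin.zero FinP.≟ b) c) ≡⟨ ∑-allFin-suc {B} (λ b → when (Fin.zero FinP.≟ b) c) ⟩
  c + ∑ (allFin B) (λ _ → 0ℚ)                            ≡⟨ cong (_+_ c) (∑-zero (allFin B)) ⟩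
  c + 0ℚ                                                 ≡⟨ ℚP.+-identityʳ c ⟩
  c                                                      ∎
  where open ≡-Reasoning
∑-allFin-when-≟ {suc B} (Fin.suc a) c =
  trans (∑-allFin-suc {B} (λ b → when (Fin.suc a FinP.≟ b) c)) (trans (ℚP.+-identityˡ _) (∑-allFin-when-≟ a c))

∑-fibres : ∀ {a} {A : Set a} {B} (f : A → Fin B) (g : A → ℚ) xs →
           ∑ (allFin B) (λ b → ∑ (filter (λ x → f x FinP.≟ b) xs) g) ≡ ∑ xs g
∑-fibres {B = B} f g xs = begin
  ∑ (allFin B) (λ b → ∑ (filter (λ x → f x FinP.≟ b) xs) g)
    ≡⟨ ∑-cong (allFin B) (λ b → ∑-filter (λ x → f x FinP.≟ b) g xs) ⟩
  ∑ (allFin B) (λ b → ∑ xs (λ x → when (f x FinP.≟ b) (g x)))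
    ≡⟨ ∑-comm (allFin B) xs (λ b x → when (f x FinP.≟ b) (g x)) ⟩
  ∑ xs (λ x → ∑ (allFin B) (λ b → when (f x FinP.≟ b) (g x)))
    ≡⟨ ∑-cong xs (λ x → ∑-allFin-when-≟ (f x) (g x)) ⟩
  ∑ xs g ∎
  where open ≡-Reasoning

module _ {a} {A : Set a} (_≟_ : DecidableEquality A) where

  ∑-when-≟-none : ∀ x c {zs} → All (λ z → x ≢ z) zs → ∑ zs (λ z → when (x ≟ z) c) ≡ 0ℚ
  ∑-when-≟-none x c []               = refl
  ∑-when-≟-none x c {z ∷ _} (x≢z ∷ x∉zs) with x ≟ z
  ... | yes x≡z = contradiction x≡z x≢z
  ... | no  _   = trans (ℚP.+-identityˡ _) (∑-when-≟-none x c x∉zs)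

  ∑-when-≟-unique-≤ : ∀ x {c} {zs} → Unique zs → 0ℚ ≤ c → ∑ zs (λ z → when (x ≟ z) c) ≤ c
  ∑-when-≟-unique-≤ x []                      c≥0 = c≥0
  ∑-when-≟-unique-≤ x {c} {z ∷ zs} (z∉zs ∷ uniq) c≥0 with x ≟ z
  ... | yes refl = ℚP.≤-reflexive (trans (cong (_+_ c) (∑-when-≟-none x c z∉zs)) (ℚP.+-identityʳ c))
  ... | no  _    = ℚP.≤-trans (ℚP.≤-reflexive (ℚP.+-identityˡ _)) (∑-when-≟-unique-≤ x uniq c≥0)

  ∑-classes-≤ : ∀ {i p} {I : Set i} {P : Pred I p} (P? : Decidable P) (key : I → A) (h : I → ℚ) →
                (∀ x → 0ℚ ≤ h x) → ∀ {zs} → Unique zs → ∀ xs →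
                ∑ zs (λ z → ∑ (filter (λ x → P? x ×-dec (key x ≟ z)) xs) h) ≤ ∑ (filter P? xs) h
  ∑-classes-≤ P? key h h≥0 {zs} uniq xs = begin
    ∑ zs (λ z → ∑ (filter (λ x → P? x ×-dec (key x ≟ z)) xs) h)
      ≡⟨ ∑-cong zs (λ z → ∑-filter (λ x → P? x ×-dec (key x ≟ z)) h xs) ⟩
    ∑ zs (λ z → ∑ xs (λ x → when (P? x ×-dec (key x ≟ z)) (h x)))
      ≡⟨ ∑-comm zs xs (λ z x → when (P? x ×-dec (key x ≟ z)) (h x)) ⟩
    ∑ xs (λ x → ∑ zs (λ z → when (P? x ×-dec (key x ≟ z)) (h x)))
      ≤⟨ ∑-mono-≤ xs class-≤ ⟩
    ∑ xs (λ x → when (P? x) (h x))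
      ≡⟨ ∑-filter P? h xs ⟨
    ∑ (filter P? xs) h ∎
    where
    open ℚP.≤-Reasoning
    class-≤ : ∀ x → ∑ zs (λ z → when (P? x ×-dec (key x ≟ z)) (h x)) ≤ when (P? x) (h x)
    class-≤ x with P? x
    ... | yes _ = ∑-when-≟-unique-≤ (key x) uniq (h≥0 x)
    ... | no  _ = ℚP.≤-reflexive (∑-zero zs)

∑-filter-fibres : ∀ {a p} {A : Set a} {P : Pred A p} (P? : Decidable P) {B} (f : A → Fin B) (g : A → ℚ) xs →
                  ∑ (filter P? xs) g ≡ ∑ (allFin B) (λ b → ∑ (filter P? (filter (λ x → f x FinP.≟ b) xs)) g)
∑-filter-fibres P? {B} f g xs = begin
  ∑ (filter P? xs) g
    ≡⟨ ∑-filter P? g xs ⟩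
  ∑ xs (λ x → when (P? x) (g x))
    ≡⟨ ∑-fibres f (λ x → when (P? x) (g x)) xs ⟨
  ∑ (allFin B) (λ b → ∑ (filter (λ x → f x FinP.≟ b) xs) (λ x → when (P? x) (g x)))
    ≡⟨ ∑-cong (allFin B) (λ b → ∑-filter P? g (filter (λ x → f x FinP.≟ b) xs)) ⟨
  ∑ (allFin B) (λ b → ∑ (filter P? (filter (λ x → f x FinP.≟ b) xs)) g) ∎
  where open ≡-Reasoning

ℚ-of-sum : ∀ {a} {A : Set a} (h : A → ℕ) xs → ℚ-of (ListAction.sum (map h xs)) ≡ ∑ xs (λ x → ℚ-of (h x))
ℚ-of-sum h []       = refl
ℚ-of-sum h (x ∷ xs) = trans (ℚ-of-+ (h x) _) (cong (_+_ (ℚ-of (h x))) (ℚ-of-sum h xs))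

ℚ-of-/-≤ : ∀ a k .{{_ : NonZero k}} → ℚ-of (a ℕ./ k) ≤ ℚ-of a * (+ 1 / k)
ℚ-of-/-≤ a k = begin
  ℚ-of (a ℕ./ k)                       ≡⟨ ℚP.*-identityʳ _ ⟨
  ℚ-of (a ℕ./ k) * 1ℚ                  ≡⟨ cong (_*_ (ℚ-of (a ℕ./ k))) (ℚ-of-*-1/ k) ⟨
  ℚ-of (a ℕ./ k) * (ℚ-of k * (+ 1 / k)) ≡⟨ ℚP.*-assoc (ℚ-of (a ℕ./ k)) (ℚ-of k) _ ⟨
  ℚ-of (a ℕ./ k) * ℚ-of k * (+ 1 / k)   ≡⟨ cong (_* (+ 1 / k)) (ℚ-of-* (a ℕ./ k) k) ⟨
  ℚ-of (a ℕ./ k ℕ.* k) * (+ 1 / k)      ≤⟨ ℚP.*-monoʳ-≤-nonNeg (+ 1 / k) {{ℚP.normalize-nonNeg 1 k}}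
                                             (ℚ-of-mono-≤ (DivMod.m/n*n≤m a k)) ⟩
  ℚ-of a * (+ 1 / k)                    ∎
  where open ℚP.≤-Reasoning

m≤[1+[m∸1]/n]*n : ∀ m n .{{_ : NonZero n}} → m ℕ.≤ suc ((m ℕ.∸ 1) ℕ./ n) ℕ.* n
m≤[1+[m∸1]/n]*n zero    n = ℕ.z≤n
m≤[1+[m∸1]/n]*n (suc m) n = begin
  suc m                            ≡⟨ cong suc (DivMod.m≡m%n+[m/n]*n m n) ⟩
  suc (m ℕ.% n ℕ.+ m ℕ./ n ℕ.* n)  ≤⟨ ℕP.+-monoˡ-≤ (m ℕ./ n ℕ.* n) (DivMod.m%n<n m n) ⟩
  n ℕ.+ m ℕ./ n ℕ.* n              ∎
  where open ℕP.≤-Reasoning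

module Packing (m k : ℕ) (m≢0 : NonZero m) (k≢0 : NonZero k) (U : ℚ) (U>0 : 0ℚ < U)
               {n : ℕ} (s : Fin n → ℚ) (s≥0 : ∀ i → 0ℚ ≤ s i) {B : ℕ} (f : Fin n → Fin B) where

  open Setting m k m≢0 k≢0 U s

  private instance
    k≢0-instance : NonZero k
    k≢0-instance = k≢0
    U-nonNeg : NonNegative U
    U-nonNeg = nonNegative (ℚP.<⇒≤ U>0)

  loadWith-≥ : ∀ E Λ → ∑ E s + ∑ Λ s + ℚ-of ((length E ℕ.+ length Λ ℕ.∸ 1) ℕ./ k) * U ≤ loadWith f E Λ
  loadWith-≥ E [] rewrite ℕP.+-identityʳ (length E) | ℚP.+-identityʳ (∑ E s) = ℚP.≤-refl
  loadWith-≥ E Λ@(_ ∷ _) = begin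
    ∑ E s + ∑ Λ s + ℚ-of ((length E ℕ.+ length Λ ℕ.∸ 1) ℕ./ k) * U
      ≤⟨ ℚP.+-monoʳ-≤ (∑ E s + ∑ Λ s) (ℚP.*-monoʳ-≤-nonNeg U (ℚP.≤-trans
           (ℚ-of-/-≤ (length E ℕ.+ length Λ ℕ.∸ 1) k) (ℚP.*-monoʳ-≤-nonNeg 1/k {{ℚP.normalize-nonNeg 1 k}}
             (ℚ-of-mono-≤ (ℕP.m∸n≤m (length E ℕ.+ length Λ) 1))))) ⟩
    ∑ E s + ∑ Λ s + ℚ-of (length E ℕ.+ length Λ) * 1/k * U
      ≡⟨ cong (λ x → ∑ E s + ∑ Λ s + x * 1/k * U) (ℚ-of-+ (length E) (length Λ)) ⟩
    ∑ E s + ∑ Λ s + (ℚ-of (length E) + ℚ-of (length Λ)) * 1/k * U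
      ≡⟨ solve 6 (λ e l |E| |Λ| t u → e :+ l :+ (|E| :+ |Λ|) :* t :* u
                                    := e :+ (l :+ |Λ| :* (u :* t)) :+ |E| :* t :* u)
               refl (∑ E s) (∑ Λ s) (ℚ-of (length E)) (ℚ-of (length Λ)) 1/k U ⟩
    ∑ E s + (∑ Λ s + ℚ-of (length Λ) * (U * 1/k)) + ℚ-of (length E) * 1/k * U
      ≡⟨ cong (λ x → ∑ E s + x + ℚ-of (length E) * 1/k * U) ∑Λs̃ ⟨
    ∑ E s + ∑ Λ s̃ + ℚ-of (length E) * 1/k * U
      ∎
    where
    open ℚP.≤-Reasoning
    open +-*-Solver
    1/k : ℚ
    1/k = + 1 / k
    ∑Λs̃ : ∑ Λ s̃ ≡ ∑ Λ s + ℚ-of (length Λ) * (U * 1/k)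
    ∑Λs̃ = trans (∑-distrib-+ s (λ _ → U * 1/k) Λ) (cong (_+_ (∑ Λ s)) (∑-const Λ (U * 1/k)))

  bin : Fin B → List (Fin n)
  bin = binItems f

  penalty : Fin B → ℕ
  penalty b = (length (bin b) ℕ.∸ 1) ℕ./ k

  bin-load-≥ : ∀ b → ∑ (bin b) s + ℚ-of (penalty b) * U ≤ load f b
  bin-load-≥ b = begin
    ∑ (bin b) s + ℚ-of (penalty b) * U
      ≡⟨ cong₂ (λ x y → x + ℚ-of ((y ℕ.∸ 1) ℕ./ k) * U)
               (∑-partition (early? f) s (bin b)) (length-partition (early? f) (bin b)) ⟨
    ∑ (Early f b) s + ∑ (Late f b) s + ℚ-of ((length (Early f b) ℕ.+ length (Late f b) ℕ.∸ 1) ℕ./ k) * U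
      ≤⟨ loadWith-≥ (Early f b) (Late f b) ⟩
    load f b ∎
    where open ℚP.≤-Reasoning

  ∑-small+∑-large : ∀ (g : Fin n → ℚ) xs → ∑ (filter small? xs) g + ∑ (filter large? xs) g ≡ ∑ xs g
  ∑-small+∑-large g xs = begin
    ∑ (filter small? xs) g + ∑ (filter large? xs) g
      ≡⟨ cong (λ ys → ∑ (filter small? xs) g + ∑ ys g) (LP.filter-≐ (λ i → ¬? (small? i)) large? ¬small≐large xs) ⟨
    ∑ (filter small? xs) g + ∑ (filter (λ i → ¬? (small? i)) xs) g
      ≡⟨ ∑-partition small? g xs ⟩
    ∑ xs g ∎
    where
    open ≡-Reasoning
    ¬small≐large : (λ i → ¬ Small i) ≐ (λ i → ε ≤ s i)
    ¬small≐large = ℚP.≮⇒≥ , λ ε≤sᵢ sᵢ<ε → ℚP.<-irrefl refl (ℚP.<-≤-trans sᵢ<ε ε≤sᵢ)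

  OfSize? : (z : ℚ) (i : Fin n) → Dec ((ε ≤ s i) × (s i ≡ z))
  OfSize? z i = large? i ×-dec (s i ℚP.≟ z)

  multiplicity : Fin B → ℚ → ℕ
  multiplicity b z = length (filter (OfSize? z) (bin b))

  binConfig : Fin B → Config
  binConfig b = record
    { α = λ j → multiplicity b (zAt j) ; δ = suc (penalty b) ; γ = Fin.zero ; γ' = false ; γ'0 = λ _ → refl }

  largeLoad : Fin B → ℚ
  largeLoad b = ∑ (allFin nZ) (λ j → ℚ-of (multiplicity b (zAt j)) * zAt j)

  smallLoad : Fin B → ℚ
  smallLoad b = ∑ (filter small? (bin b)) s

  L-binConfig : ∀ b → L (binConfig b) ≡ largeLoad b + ℚ-of (penalty b) * U
  L-binConfig b = begin
    largeLoad b + ℚ-of 0 * ε + (ℚ-of (suc (penalty b) ℕ.+ 0) - 1ℚ) * U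
      ≡⟨ cong (λ x → largeLoad b + ℚ-of 0 * ε + (ℚ-of x - 1ℚ) * U) (ℕP.+-identityʳ (suc (penalty b))) ⟩
    largeLoad b + ℚ-of 0 * ε + (ℚ-of (suc (penalty b)) - 1ℚ) * U
      ≡⟨ cong (λ x → largeLoad b + ℚ-of 0 * ε + (x - 1ℚ) * U) (ℚ-of-suc (penalty b)) ⟩
    largeLoad b + 0ℚ * ε + ((1ℚ + ℚ-of (penalty b)) - 1ℚ) * U
      ≡⟨ solve 4 (λ a e p u → a :+ con 0ℚ :* e :+ ((con 1ℚ :+ p) :- con 1ℚ) :* u := a :+ p :* u)
               refl (largeLoad b) ε (ℚ-of (penalty b)) U ⟩
    largeLoad b + ℚ-of (penalty b) * U ∎
    where
    open ≡-Reasoning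
    open +-*-Solver

  Z-unique : Unique Z
  Z-unique = Unique.deduplicate-! ℚP._≟_ (map s (filter large? (allFin n)))

  ∑-multiplicity-≤ : ∀ b (h : Fin n → ℚ) → (∀ i → 0ℚ ≤ h i) →
                     ∑ Z (λ z → ∑ (filter (OfSize? z) (bin b)) h) ≤ ∑ (filter large? (bin b)) h
  ∑-multiplicity-≤ b h h≥0 = ∑-classes-≤ ℚP._≟_ large? s h h≥0 Z-unique (bin b)

  largeLoad-≤ : ∀ b → largeLoad b ≤ ∑ (filter large? (bin b)) s
  largeLoad-≤ b = begin
    largeLoad b
      ≡⟨ ∑-allFin-lookup Z (λ z → ℚ-of (multiplicity b z) * z) ⟩
    ∑ Z (λ z → ℚ-of (multiplicity b z) * z)
      ≡⟨ ∑-cong Z (λ z → ∑-const (filter (OfSize? z) (bin b)) z) ⟨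
    ∑ Z (λ z → ∑ (filter (OfSize? z) (bin b)) (λ _ → z))
      ≡⟨ ∑-cong Z (λ z → ∑-filter-cong (OfSize? z) (bin b) (λ i (_ , sᵢ≡z) → sym sᵢ≡z)) ⟩
    ∑ Z (λ z → ∑ (filter (OfSize? z) (bin b)) s)
      ≤⟨ ∑-multiplicity-≤ b s s≥0 ⟩
    ∑ (filter large? (bin b)) s ∎
    where open ℚP.≤-Reasoning

  largeCount-≤ : ∀ b → ℚ-of (Σα (binConfig b)) ≤ ∑ (filter large? (bin b)) (λ _ → 1ℚ)
  largeCount-≤ b = begin
    ℚ-of (Σα (binConfig b))
      ≡⟨ ℚ-of-sum (λ j → multiplicity b (zAt j)) (allFin nZ) ⟩
    ∑ (allFin nZ) (λ j → ℚ-of (multiplicity b (zAt j)))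
      ≡⟨ ∑-allFin-lookup Z (λ z → ℚ-of (multiplicity b z)) ⟩
    ∑ Z (λ z → ℚ-of (multiplicity b z))
      ≡⟨ ∑-cong Z (λ z → ℚ-of-length (filter (OfSize? z) (bin b))) ⟩
    ∑ Z (λ z → ∑ (filter (OfSize? z) (bin b)) (λ _ → 1ℚ))
      ≤⟨ ∑-multiplicity-≤ b (λ _ → 1ℚ) (λ _ → ℚP.nonNegative⁻¹ 1ℚ) ⟩
    ∑ (filter large? (bin b)) (λ _ → 1ℚ) ∎
    where open ℚP.≤-Reasoning

  binConfig-items-≤ : ∀ b → ℚ-of (Σα (binConfig b)) + ∑ (filter small? (bin b)) (λ _ → 1ℚ)
                            ≤ ℚ-of (δ (binConfig b) ℕ.* k)
  binConfig-items-≤ b = begin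
    ℚ-of (Σα (binConfig b)) + ∑ (filter small? (bin b)) (λ _ → 1ℚ)
      ≤⟨ ℚP.+-monoˡ-≤ _ (largeCount-≤ b) ⟩
    ∑ (filter large? (bin b)) (λ _ → 1ℚ) + ∑ (filter small? (bin b)) (λ _ → 1ℚ)
      ≡⟨ ℚP.+-comm (∑ (filter large? (bin b)) (λ _ → 1ℚ)) (∑ (filter small? (bin b)) (λ _ → 1ℚ)) ⟩
    ∑ (filter small? (bin b)) (λ _ → 1ℚ) + ∑ (filter large? (bin b)) (λ _ → 1ℚ)
      ≡⟨ ∑-small+∑-large (λ _ → 1ℚ) (bin b) ⟩
    ∑ (bin b) (λ _ → 1ℚ)
      ≡⟨ ℚ-of-length (bin b) ⟨
    ℚ-of (length (bin b))
      ≤⟨ ℚ-of-mono-≤ (m≤[1+[m∸1]/n]*n (length (bin b)) k) ⟩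
    ℚ-of (δ (binConfig b) ℕ.* k) ∎
    where open ℚP.≤-Reasoning

  u : List (Config × ℚ)
  u = map (λ b → binConfig b , 1ℚ) (allFin B)

  v : Fin n → Fin (suc m) → ℚ
  v i Fin.zero    = 1ℚ
  v i (Fin.suc _) = 0ℚ

  w : Fin n → Fin (suc m) → ℚ
  w i η = 0ℚ

  Σc-u : ∀ g → Σc u g ≡ ∑ (allFin B) (λ b → g (binConfig b))
  Σc-u g = trans (cong Σℚ (sym (LP.map-∘ (allFin B))))
                 (∑-cong (allFin B) (λ b → ℚP.*-identityˡ (g (binConfig b))))

  Σcη-u-zero : ∀ g → Σcη u Fin.zero g ≡ ∑ (allFin B) (λ b → g (binConfig b))
  Σcη-u-zero g = trans (cong (λ us → Σc us g) (LP.filter-all (λ p → γ (proj₁ p) FinP.≟ Fin.zero)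
                         (AllP.map⁺ (All.universal (λ _ → refl) (allFin B)))))
                       (Σc-u g)

  Σcη-u-suc : ∀ e g → Σcη u (Fin.suc e) g ≡ 0ℚ
  Σcη-u-suc e g = cong (λ us → Σc us g) (LP.filter-none (λ p → γ (proj₁ p) FinP.≟ Fin.suc e)
                    (AllP.map⁺ (All.universal (λ _ ()) (allFin B))))

  ΣS-by-bin : ∀ g → ΣS g ≡ ∑ (allFin B) (λ b → ∑ (filter small? (bin b)) g)
  ΣS-by-bin g = ∑-filter-fibres small? f g (allFin n)

  v≥0 : ∀ i η → 0ℚ ≤ v i η
  v≥0 i Fin.zero    = ℚP.nonNegative⁻¹ 1ℚ
  v≥0 i (Fin.suc _) = ℚP.≤-refl

  w≥0 : ∀ i η → 0ℚ ≤ w i η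
  w≥0 i η = ℚP.≤-refl

  large-demand : (j : Fin nZ) → ℚ-of (count (zAt j)) ≤ Σc u (λ c → ℚ-of (α c j))
  large-demand j = ℚP.≤-reflexive (begin
    ℚ-of (count (zAt j))
      ≡⟨ ℚ-of-length (filter (OfSize? (zAt j)) (allFin n)) ⟩
    ∑ (filter (OfSize? (zAt j)) (allFin n)) (λ _ → 1ℚ)
      ≡⟨ ∑-filter-fibres (OfSize? (zAt j)) f (λ _ → 1ℚ) (allFin n) ⟩
    ∑ (allFin B) (λ b → ∑ (filter (OfSize? (zAt j)) (bin b)) (λ _ → 1ℚ))
      ≡⟨ ∑-cong (allFin B) (λ b → ℚ-of-length (filter (OfSize? (zAt j)) (bin b))) ⟨
    ∑ (allFin B) (λ b → ℚ-of (multiplicity b (zAt j)))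
      ≡⟨ Σc-u (λ c → ℚ-of (α c j)) ⟨
    Σc u (λ c → ℚ-of (α c j)) ∎)
    where open ≡-Reasoning

  small-cover : (i : Fin n) → Small i → 1ℚ ≤ Σℚ (map (λ η → v i η + w i η) (allFin (suc m)))
  small-cover i _ = ℚP.≤-reflexive (sym (begin
    ∑ (allFin (suc m)) (λ η → v i η + w i η) ≡⟨ ∑-allFin-suc (λ η → v i η + w i η) ⟩
    (1ℚ + 0ℚ) + ∑ (allFin m) (λ _ → 0ℚ + 0ℚ)  ≡⟨ cong (_+_ (1ℚ + 0ℚ)) (∑-zero (allFin m)) ⟩
    1ℚ                                         ∎))
    where open ≡-Reasoning

  late-capacity : (η : Fin (suc m)) →
                  ΣS (λ i → w i η * s̃ i) ≤ Σcη u η (λ c → ℚ-of (bit (γ' c) ℕ.* (toℕ (γ c) ℕ.+ 1)) * ε)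
  late-capacity η = ℚP.≤-reflexive (trans (∑-zero-* smallItems s̃) (sym (no-late-capacity η)))
    where
    no-late-capacity : ∀ η → Σcη u η (λ c → ℚ-of (bit (γ' c) ℕ.* (toℕ (γ c) ℕ.+ 1)) * ε) ≡ 0ℚ
    no-late-capacity Fin.zero    = trans (Σcη-u-zero _) (∑-zero-* (allFin B) (λ _ → ε))
    no-late-capacity (Fin.suc e) = Σcη-u-suc e _

  item-count : (η : Fin (suc m)) →
               Σcη u η (λ c → ℚ-of (Σα c)) + ΣS (λ i → v i η) ≤ Σcη u η (λ c → ℚ-of (δ c ℕ.* k))
  item-count Fin.zero = begin
    Σcη u Fin.zero (λ c → ℚ-of (Σα c)) + ΣS (λ _ → 1ℚ)
      ≡⟨ cong₂ _+_ (Σcη-u-zero (λ c → ℚ-of (Σα c))) (ΣS-by-bin (λ _ → 1ℚ)) ⟩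
    ∑ (allFin B) (λ b → ℚ-of (Σα (binConfig b))) + ∑ (allFin B) (λ b → ∑ (filter small? (bin b)) (λ _ → 1ℚ))
      ≡⟨ ∑-distrib-+ _ _ (allFin B) ⟨
    ∑ (allFin B) (λ b → ℚ-of (Σα (binConfig b)) + ∑ (filter small? (bin b)) (λ _ → 1ℚ))
      ≤⟨ ∑-mono-≤ (allFin B) binConfig-items-≤ ⟩
    ∑ (allFin B) (λ b → ℚ-of (δ (binConfig b) ℕ.* k))
      ≡⟨ Σcη-u-zero (λ c → ℚ-of (δ c ℕ.* k)) ⟨
    Σcη u Fin.zero (λ c → ℚ-of (δ c ℕ.* k)) ∎
    where open ℚP.≤-Reasoning
  item-count (Fin.suc e) = ℚP.≤-reflexive (begin
    Σcη u (Fin.suc e) (λ c → ℚ-of (Σα c)) + ΣS (λ _ → 0ℚ) ≡⟨ cong₂ _+_ (Σcη-u-suc e _) (∑-zero smallItems) ⟩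
    0ℚ                                                    ≡⟨ Σcη-u-suc e _ ⟨
    Σcη u (Fin.suc e) (λ c → ℚ-of (δ c ℕ.* k))            ∎)
    where open ≡-Reasoning

  cost-u : cost u ≤ ℚ-of B
  cost-u = ℚP.≤-reflexive (begin
    Σℚ (map proj₂ u)             ≡⟨ cong Σℚ (LP.map-∘ (allFin B)) ⟨
    ∑ (allFin B) (λ _ → 1ℚ)      ≡⟨ ℚ-of-length (allFin B) ⟨
    ℚ-of (length (allFin B))     ≡⟨ cong ℚ-of (LP.length-tabulate {n = B} (λ b → b)) ⟩
    ℚ-of B                       ∎)
    where open ≡-Reasoning

  module _ (feasible : FeasibleBPUP' f) where

    smallLoad+L-binConfig-≤1 : ∀ b → smallLoad b + L (binConfig b) ≤ 1ℚ
    smallLoad+L-binConfig-≤1 b = begin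
      smallLoad b + L (binConfig b)
        ≡⟨ cong (_+_ (smallLoad b)) (L-binConfig b) ⟩
      smallLoad b + (largeLoad b + ℚ-of (penalty b) * U)
        ≤⟨ ℚP.+-monoʳ-≤ (smallLoad b) (ℚP.+-monoˡ-≤ _ (largeLoad-≤ b)) ⟩
      smallLoad b + (∑ (filter large? (bin b)) s + ℚ-of (penalty b) * U)
        ≡⟨ ℚP.+-assoc (smallLoad b) _ _ ⟨
      smallLoad b + ∑ (filter large? (bin b)) s + ℚ-of (penalty b) * U
        ≡⟨ cong (λ x → x + ℚ-of (penalty b) * U) (∑-small+∑-large s (bin b)) ⟩
      ∑ (bin b) s + ℚ-of (penalty b) * U
        ≤⟨ bin-load-≥ b ⟩
      load f b
        ≤⟨ feasible b ⟩
      1ℚ ∎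
      where open ℚP.≤-Reasoning

    binConfig-feasible : ∀ b → FeasibleConfig (binConfig b)
    binConfig-feasible b = begin
      L (binConfig b)                ≡⟨ ℚP.+-identityˡ (L (binConfig b)) ⟨
      0ℚ + L (binConfig b)           ≤⟨ ℚP.+-monoˡ-≤ (L (binConfig b)) (∑-nonNeg (filter small? (bin b)) s≥0) ⟩
      smallLoad b + L (binConfig b)  ≤⟨ smallLoad+L-binConfig-≤1 b ⟩
      1ℚ                             ∎
      where open ℚP.≤-Reasoning

    smallLoad-≤-β : ∀ b → smallLoad b ≤ β (binConfig b)
    smallLoad-≤-β b = begin
      smallLoad b
        ≡⟨ solve 2 (λ x l → x := x :+ l :- l) refl (smallLoad b) (L (binConfig b)) ⟩
      smallLoad b + L (binConfig b) - L (binConfig b)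
        ≤⟨ ℚP.+-monoˡ-≤ _ (smallLoad+L-binConfig-≤1 b) ⟩
      β (binConfig b) ∎
      where
      open ℚP.≤-Reasoning
      open +-*-Solver

    u-feasible : All (λ p → FeasibleConfig (proj₁ p) × (0ℚ ≤ proj₂ p)) u
    u-feasible = AllP.map⁺ (AllP.tabulate⁺ (λ b → binConfig-feasible b , ℚP.nonNegative⁻¹ 1ℚ))

    small-capacity : (η : Fin (suc m)) → ΣS (λ i → v i η * s i) ≤ Σcη u η β
    small-capacity Fin.zero = begin
      ΣS (λ i → 1ℚ * s i)                      ≡⟨ ∑-cong smallItems (λ i → ℚP.*-identityˡ (s i)) ⟩
      ΣS s                                     ≡⟨ ΣS-by-bin s ⟩
      ∑ (allFin B) smallLoad                   ≤⟨ ∑-mono-≤ (allFin B) smallLoad-≤-β ⟩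
      ∑ (allFin B) (λ b → β (binConfig b))     ≡⟨ Σcη-u-zero β ⟨
      Σcη u Fin.zero β                         ∎
      where open ℚP.≤-Reasoning
    small-capacity (Fin.suc e) = ℚP.≤-reflexive (trans (∑-zero-* smallItems s) (sym (Σcη-u-suc e β)))

theorem5 : (m k : ℕ) (m≢0 : NonZero m) (k≢0 : NonZero k)
    (U : ℚ) (U>0 : 0ℚ < U) → U ≤ 1ℚ →
    + (m ℕ.* m) ℤ.< floor (kOverU k U U>0) ℤ.+ + k →
    (n : ℕ) (s : Fin n → ℚ) → SizesIn01 s →
    (B : ℕ) (f : Fin n → Fin B) →
    Setting.FeasibleBPUP' m k m≢0 k≢0 U s f →
    Setting.LPSolvableWithin m k m≢0 k≢0 U s (ℚ-of B)
theorem5 m k m≢0 k≢0 U U>0 _ _ n s sizes B f feasible =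
  u , v , w
  , ( u-feasible feasible , v≥0 , w≥0
    , large-demand , small-cover , small-capacity feasible , late-capacity , item-count )
  , cost-u
  where open Packing m k m≢0 k≢0 U U>0 s (λ i → proj₁ (sizes i)) f
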